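{- Let $S\subseteq\mathbb{Z}^+$ and $u\in S$. Then for all integers $n,k,r\ge 0$, $$ {n\brace k}_{S,r}=\sum_{i=0}^r\sum_{j=0}^k\binom{r}{i}\frac{n!}{(u-1)!^i\,u!^j\,j!\,(n-(u-1)i-uj)!}{n-(u-1)i-uj\brace k-j}_{S\setminus\{u\},\,r-i}. $$
   Context: For $T\subseteq\mathbb{Z}^+$ and integers $n,k,r\ge 0$, ${n\brace k}_{T,r}$ is the number of set partitions of $[n+r]$ into $k+r$ non-empty blocks such that $1,\dots,r$ lie in distinct blocks and every block has cardinality in $T$. Terms with $n-(u-1)i-uj<0$ are taken to be $0$. -}

module Defs where

open import Data.Bool using (Bool; true; false; _∧_; not; if_then_else_)
open import Data.Nat using (ℕ; zero; suc; _+_; _*_; _∸_; _^_; _<ᵇ_; _≤ᵇ_; _≡ᵇ_; _⊔_; _/_; NonZero)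
open import Data.Nat.Properties using (_!≢0; m*n≢0; m^n≢0)
open import Data.Nat.Combinatorics using (_C_)
open import Data.Nat.Base using (_!)
open import Data.Fin using (Fin; toℕ; _≟_)
open import Data.List using (List; []; _∷_; [_]; map; concatMap; allFin; length; filterᵇ; upTo; foldr; take)
open import Data.Nat.ListAction using (sum)
open import Data.Vec using (Vec; toList) renaming ([] to []ᵥ; _∷_ to _∷ᵥ_)
open import Relation.Nullary.Decidable using (⌊_⌋)

-- A subset T ⊆ ℤ⁺ is represented by its (decidable) characteristic
-- function ℕ → Bool (the value at 0 is constrained separately where
-- needed; it never matters, since blocks are non-empty).

Subset : Set
Subset = ℕ → Bool

_∖｛_｝ : Subset → ℕ → Subset
(T ∖｛ u ｝) t = T t ∧ not (t ≡ᵇ u)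

-- Set partitions of [m] = {1,…,m} (positions 0,…,m-1 of a vector) into
-- exactly b blocks are encoded canonically as restricted growth strings:
-- v : Vec (Fin b) m, where v[x] is the index of the block containing x,
-- blocks being numbered 0,1,… in order of their least elements.  This is
-- a bijection between set partitions into b non-empty blocks and RGSs of
-- length m with all b labels used.

allVecs : (m b : ℕ) → List (Vec (Fin b) m)
allVecs zero    b = [ []ᵥ ]
allVecs (suc m) b = concatMap (λ x → map (x ∷ᵥ_) (allVecs m b)) (allFin b)

rgsFrom : ℕ → List ℕ → Bool
rgsFrom used []       = true
rgsFrom used (x ∷ xs) = (x <ᵇ suc used) ∧ rgsFrom (used ⊔ suc x) xs

isRGS : ∀ {m b} → Vec (Fin b) m → Bool
isRGS v = rgsFrom 0 (map toℕ (toList v))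

allB : ∀ {A : Set} → (A → Bool) → List A → Bool
allB p = foldr (λ x acc → p x ∧ acc) true

blockSize : ∀ {m b} → Vec (Fin b) m → Fin b → ℕ
blockSize v j = length (filterᵇ (λ x → ⌊ x ≟ j ⌋) (toList v))

blocksOK : ∀ {m b} → Subset → Vec (Fin b) m → Bool
blocksOK {b = b} T v = allB (λ j → (1 ≤ᵇ blockSize v j) ∧ T (blockSize v j)) (allFin b)

allDistinct : ∀ {b} → List (Fin b) → Bool
allDistinct []       = true
allDistinct (x ∷ xs) = allB (λ y → not ⌊ x ≟ y ⌋) xs ∧ allDistinct xs

-- the elements 1,…,r (first r positions) lie in distinct blocks
firstDistinct : ∀ {m b} → ℕ → Vec (Fin b) m → Bool
firstDistinct r v = allDistinct (take r (toList v))

isRTPartition : ∀ {m b} → Subset → ℕ → Vec (Fin b) m → Bool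
isRTPartition T r v = isRGS v ∧ blocksOK T v ∧ firstDistinct r v

-- {n brace k}_{T,r}: the number of set partitions of [n+r] into k+r
-- non-empty blocks, 1..r in distinct blocks, all block sizes in T.
stirlingTR : Subset → (n k r : ℕ) → ℕ
stirlingTR T n k r = length (filterᵇ (isRTPartition T r) (allVecs (n + r) (k + r)))

sumTo : ℕ → (ℕ → ℕ) → ℕ
sumTo N f = sum (map f (upTo (suc N)))

denom : (n u i j : ℕ) → ℕ
denom n u i j = (((u ∸ 1) !) ^ i) * ((u !) ^ j) * (j !) * ((n ∸ ((u ∸ 1) * i + u * j)) !)

denom≢0 : ∀ n u i j → NonZero (denom n u i j)
denom≢0 n u i j =
  m*n≢0 _ _ {{m*n≢0 _ _ {{m*n≢0 _ _ {{m^n≢0 _ i {{(u ∸ 1) !≢0}}}} {{m^n≢0 _ j {{u !≢0}}}}}} {{j !≢0}}}}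
        {{(n ∸ ((u ∸ 1) * i + u * j)) !≢0}}

-- n! / ((u-1)!^i u!^j j! (n-(u-1)i-uj)!)   (exact: a multinomial coefficient)
coeff : (n u i j : ℕ) → ℕ
coeff n u i j = (n ! / denom n u i j) {{denom≢0 n u i j}}

{-# OPTIONS --safe #-}
module Submission where

-- Classify the partitions counted by {n brace k}_{T,r+1} by the block of the first distinguished
-- element: if it has t + 1 elements, t of them are chosen among the n free ones, so
--   {n brace k}_{T,r+1} = Σ_t C(n,t) [t+1 ∈ T] {n−t brace k}_{T,r},
-- and {n+1 brace k+1}_{T,0} = {n brace k}_{T,1} by declaring the first element distinguished.
-- For T = S the summand with t + 1 = u splits off as C(n,u−1) {n−u+1 brace k}_{S,r}, leaving the
-- same recurrence for S ∖ {u}. The right-hand side obeys this split recurrence too: by Pascal's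
-- rule for C(r+1,i) the first distinguished element either lies in one of the i blocks of size
-- u − 1, or its block is peeled off by the recurrence for S ∖ {u}, a choice that commutes with
-- choosing the blocks of sizes u − 1 and u. Both sides also satisfy the shift identity and agree
-- on the empty set, so induction on r, with strong induction on n for r = 0, gives the theorem.
-- Partitions are counted through their restricted growth strings: removing block 0 from such a
-- string leaves the set of its other positions and a restricted growth string on the rest.

open import Defs
open import Data.Bool using (Bool; true; false; if_then_else_; _∧_; not) renaming (T to True)
open import Data.Bool.Properties using (∧-identityʳ; ∧-commutativeMonoid)
open import Data.Nat
  using (ℕ; zero; suc; _+_; _*_; _∸_; _^_; _!; _≤_; _<_; _≡ᵇ_; _≤ᵇ_; _<ᵇ_; _⊔_; z≤n; s≤s)
open import Data.Nat.Properties hiding (_≟_)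
open import Data.Nat.Combinatorics
  using (_C_; k>n⇒nCk≡0; nCk+nC[k+1]≡[n+1]C[k+1]; nCk≡n!/k![n-k]!; k![n∸k]!∣n!; nCk≡nC[n∸k])
open import Data.Nat.DivMod using (_/_; m/n*n≡m; m*n/n≡m)
open import Data.Nat.Induction using (<-rec)
open import Data.Nat.ListAction using () renaming (sum to sumList)
open import Data.Nat.ListAction.Properties using () renaming (sum-++ to sumList-++)
open import Data.Nat.Solver using (module +-*-Solver)
open import Data.Fin using (Fin; toℕ; _≟_) renaming (zero to fzero; suc to fsuc)
open import Data.Fin.Properties using (toℕ<n; toℕ-fromℕ; toℕ-inject₁)
open import Data.Vec using (Vec; []; _∷_; toList)
open import Data.List
  using (List; []; _∷_; _++_; map; take; filterᵇ; length; concatMap; allFin; tabulate; applyUpTo)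
open import Data.List.Properties using (map-++; map-cong; map-∘; map-tabulate; map-upTo)
import Algebra.Properties.Semiring.Sum
import Algebra.Solver.CommutativeMonoid
open import Function using (_∘_; id)
open import Relation.Binary.PropositionalEquality
open import Relation.Nullary using (yes; no; contradiction)
open import Relation.Nullary.Decidable using (⌊_⌋)
open import Relation.Nullary.Reflects using (ofʸ; ofⁿ)

open +-*-Solver using (solve; _:+_; _:*_; _:=_)
open ≡-Reasoning

open module FinSum = Algebra.Properties.Semiring.Sum +-*-semiring
  using (sum; sum-cong-≗; sum-replicate-zero; sum-init-last; ∑-distrib-+; *-distribˡ-sum)

⟦_⟧ : Bool → ℕ
⟦ b ⟧ = if b then 1 else 0

⟦∧⟧ : ∀ x y → ⟦ x ∧ y ⟧ ≡ ⟦ x ⟧ * ⟦ y ⟧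
⟦∧⟧ true  y = sym (*-identityˡ ⟦ y ⟧)
⟦∧⟧ false y = refl

∑ℕ : ℕ → (ℕ → ℕ) → ℕ
∑ℕ n f = sum {n} (λ i → f (toℕ i))

infix 5 ∑ℕ
syntax ∑ℕ n (λ t → e) = ∑[ t < n ] e

∑ℕ-cong : ∀ n {f g : ℕ → ℕ} → (∀ t → t < n → f t ≡ g t) → ∑ℕ n f ≡ ∑ℕ n g
∑ℕ-cong n f≡g = sum-cong-≗ {n} (λ i → f≡g (toℕ i) (toℕ<n i))

∑ℕ-+ : ∀ n (f g : ℕ → ℕ) → ∑[ t < n ] f t + g t ≡ ∑ℕ n f + ∑ℕ n g
∑ℕ-+ n f g = ∑-distrib-+ {n} (λ i → f (toℕ i)) (λ i → g (toℕ i))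

∑ℕ-*ˡ : ∀ n c (f : ℕ → ℕ) → c * ∑ℕ n f ≡ ∑[ t < n ] c * f t
∑ℕ-*ˡ n c f = *-distribˡ-sum {n} c (λ i → f (toℕ i))

∑ℕ-comm : ∀ m n (f : ℕ → ℕ → ℕ) → ∑[ i < m ] ∑[ j < n ] f i j ≡ ∑[ j < n ] ∑[ i < m ] f i j
∑ℕ-comm m n f = FinSum.∑-comm {m} {n} (λ i j → f (toℕ i) (toℕ j))

∑ℕ-last : ∀ n (f : ℕ → ℕ) → ∑ℕ (suc n) f ≡ ∑ℕ n f + f n
∑ℕ-last n f = trans (sum-init-last {n} (λ i → f (toℕ i)))
  (cong₂ _+_ (sum-cong-≗ {n} (λ i → cong f (toℕ-inject₁ i))) (cong f (toℕ-fromℕ n)))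

∑ℕ-extend : ∀ {n} m (f : ℕ → ℕ) → n ≤ m → (∀ t → n ≤ t → f t ≡ 0) → ∑ℕ m f ≡ ∑ℕ n f
∑ℕ-extend zero    f z≤n   _      = refl
∑ℕ-extend (suc m) f n≤1+m f≡0 with _ ≤? m
... | yes n≤m = trans (∑ℕ-last m f)
  (trans (cong₂ _+_ (∑ℕ-extend m f n≤m f≡0) (f≡0 m n≤m)) (+-identityʳ _))
... | no  n≰m = cong (λ k → ∑ℕ k f) (≤-antisym (≰⇒> n≰m) n≤1+m)

∑ℕ-pick : ∀ m a (f : ℕ → ℕ) → (m ≤ a → f a ≡ 0) → ∑[ t < m ] ⟦ t ≡ᵇ a ⟧ * f t ≡ f a
∑ℕ-pick zero    a       f f≡0 = sym (f≡0 z≤n)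
∑ℕ-pick (suc m) zero    f _   =
  trans (cong (1 * f 0 +_) (sum-replicate-zero m)) (trans (+-identityʳ _) (*-identityˡ _))
∑ℕ-pick (suc m) (suc a) f f≡0 = ∑ℕ-pick m a (λ t → f (suc t)) (λ m≤a → f≡0 (s≤s m≤a))

sumList-applyUpTo : ∀ n (f : ℕ → ℕ) → sumList (applyUpTo f n) ≡ ∑ℕ n f
sumList-applyUpTo zero    f = refl
sumList-applyUpTo (suc n) f = cong (f 0 +_) (sumList-applyUpTo n (f ∘ suc))

sumTo≡∑ℕ : ∀ N (f : ℕ → ℕ) → sumTo N f ≡ ∑ℕ (suc N) f
sumTo≡∑ℕ N f = trans (cong sumList (map-upTo f (suc N))) (sumList-applyUpTo (suc N) f)

m∸n∸o≡m∸o∸n : ∀ m n o → m ∸ n ∸ o ≡ m ∸ o ∸ n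
m∸n∸o≡m∸o∸n m n o = trans (∸-+-assoc m n o) (trans (cong (m ∸_) (+-comm n o)) (sym (∸-+-assoc m o n)))

nCk*k![n∸k]!≡n! : ∀ {n k} → k ≤ n → (n C k) * (k ! * (n ∸ k) !) ≡ n !
nCk*k![n∸k]!≡n! {n} {k} k≤n = trans (cong (_* (k ! * (n ∸ k) !)) (nCk≡n!/k![n-k]! k≤n))
  (m/n*n≡m {{k !* (n ∸ k) !≢0}} (k![n∸k]!∣n! k≤n))

[k+l]Ck*k!l!≡[k+l]! : ∀ k l → ((k + l) C k) * (k ! * l !) ≡ (k + l) !
[k+l]Ck*k!l!≡[k+l]! k l = trans (cong (λ x → ((k + l) C k) * (k ! * x !)) (sym (m+n∸m≡n k l)))
  (nCk*k![n∸k]!≡n! (m≤m+n k l))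

nC[k+l]*[k+l]Ck*k!l![n∸[k+l]]!≡n! : ∀ {n} k l → k + l ≤ n →
  (n C (k + l)) * ((k + l) C k) * (k ! * l ! * (n ∸ (k + l)) !) ≡ n !
nC[k+l]*[k+l]Ck*k!l![n∸[k+l]]!≡n! {n} k l k+l≤n = begin
  (n C (k + l)) * ((k + l) C k) * (k ! * l ! * (n ∸ (k + l)) !)
    ≡⟨ solve 5 (λ a b x y z → a :* b :* (x :* y :* z) := a :* (b :* (x :* y) :* z)) refl
         (n C (k + l)) ((k + l) C k) (k !) (l !) ((n ∸ (k + l)) !) ⟩
  (n C (k + l)) * (((k + l) C k) * (k ! * l !) * (n ∸ (k + l)) !)
    ≡⟨ cong (λ x → (n C (k + l)) * (x * (n ∸ (k + l)) !)) ([k+l]Ck*k!l!≡[k+l]! k l) ⟩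
  (n C (k + l)) * ((k + l) ! * (n ∸ (k + l)) !)
    ≡⟨ nCk*k![n∸k]!≡n! k+l≤n ⟩
  n ! ∎

nCk*[n∸k]Cl*k!l![n∸[k+l]]!≡n! : ∀ {n} k l → k + l ≤ n →
  (n C k) * ((n ∸ k) C l) * (k ! * l ! * (n ∸ (k + l)) !) ≡ n !
nCk*[n∸k]Cl*k!l![n∸[k+l]]!≡n! {n} k l k+l≤n = begin
  (n C k) * ((n ∸ k) C l) * (k ! * l ! * (n ∸ (k + l)) !)
    ≡⟨ solve 5 (λ a b x y z → a :* b :* (x :* y :* z) := a :* (x :* (b :* (y :* z)))) refl
         (n C k) ((n ∸ k) C l) (k !) (l !) ((n ∸ (k + l)) !) ⟩
  (n C k) * (k ! * (((n ∸ k) C l) * (l ! * (n ∸ (k + l)) !)))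
    ≡⟨ cong (λ x → (n C k) * (k ! * (((n ∸ k) C l) * (l ! * x !)))) (sym (∸-+-assoc n k l)) ⟩
  (n C k) * (k ! * (((n ∸ k) C l) * (l ! * (n ∸ k ∸ l) !)))
    ≡⟨ cong (λ x → (n C k) * (k ! * x)) (nCk*k![n∸k]!≡n! l≤n∸k) ⟩
  (n C k) * (k ! * (n ∸ k) !)
    ≡⟨ nCk*k![n∸k]!≡n! (≤-trans (m≤m+n k l) k+l≤n) ⟩
  n ! ∎
  where
  l≤n∸k : l ≤ n ∸ k
  l≤n∸k = subst (_≤ n ∸ k) (m+n∸m≡n k l) (∸-monoˡ-≤ k k+l≤n)

nCk*[n∸k]Cl≡0 : ∀ {n} k l → n < k + l → (n C k) * ((n ∸ k) C l) ≡ 0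
nCk*[n∸k]Cl≡0 {n} k l n<k+l with k ≤? n
... | no  k≰n = cong (_* ((n ∸ k) C l)) (k>n⇒nCk≡0 (≰⇒> k≰n))
... | yes k≤n = trans (cong ((n C k) *_) (k>n⇒nCk≡0 n∸k<l)) (*-zeroʳ (n C k))
  where
  n∸k<l : n ∸ k < l
  n∸k<l = +-cancelˡ-< k (n ∸ k) l (subst (_< k + l) (sym (m+[n∸m]≡n k≤n)) n<k+l)

nC[k+l]*[k+l]Ck≡nCk*[n∸k]Cl : ∀ n k l → (n C (k + l)) * ((k + l) C k) ≡ (n C k) * ((n ∸ k) C l)
nC[k+l]*[k+l]Ck≡nCk*[n∸k]Cl n k l with k + l ≤? n
... | yes k+l≤n = *-cancelʳ-≡ _ _ (k ! * l ! * m !) {{m*n≢0 _ _ {{k !* l !≢0}} {{m !≢0}}}}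
  (trans (nC[k+l]*[k+l]Ck*k!l![n∸[k+l]]!≡n! k l k+l≤n) (sym (nCk*[n∸k]Cl*k!l![n∸[k+l]]!≡n! k l k+l≤n)))
  where
  m : ℕ
  m = n ∸ (k + l)
... | no  k+l≰n = trans (cong (_* ((k + l) C k)) (k>n⇒nCk≡0 n<k+l)) (sym (nCk*[n∸k]Cl≡0 k l n<k+l))
  where
  n<k+l : n < k + l
  n<k+l = ≰⇒> k+l≰n

nCk*[n∸k]Cl≡nCl*[n∸l]Ck : ∀ n k l → (n C k) * ((n ∸ k) C l) ≡ (n C l) * ((n ∸ l) C k)
nCk*[n∸k]Cl≡nCl*[n∸l]Ck n k l = begin
  (n C k) * ((n ∸ k) C l)       ≡⟨ sym (nC[k+l]*[k+l]Ck≡nCk*[n∸k]Cl n k l) ⟩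
  (n C (k + l)) * ((k + l) C k) ≡⟨ cong₂ _*_ (cong (n C_) (+-comm k l)) [k+l]Ck≡[l+k]Cl ⟩
  (n C (l + k)) * ((l + k) C l) ≡⟨ nC[k+l]*[k+l]Ck≡nCk*[n∸k]Cl n l k ⟩
  (n C l) * ((n ∸ l) C k)       ∎
  where
  [k+l]Ck≡[l+k]Cl : (k + l) C k ≡ (l + k) C l
  [k+l]Ck≡[l+k]Cl = begin
    (k + l) C k           ≡⟨ nCk≡nC[n∸k] (m≤m+n k l) ⟩
    (k + l) C (k + l ∸ k) ≡⟨ cong₂ _C_ (+-comm k l) (m+n∸m≡n k l) ⟩
    (l + k) C l           ∎

∑-pascal : ∀ r (f : ℕ → ℕ) → ∑[ i < suc (suc r) ] (suc r C i) * f i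
  ≡ (∑[ i < suc r ] (r C i) * f i) + (∑[ i < suc r ] (r C i) * f (suc i))
∑-pascal r f = begin
  1 * f 0 + (∑[ i < suc r ] (suc r C suc i) * f (suc i))
    ≡⟨ cong (1 * f 0 +_) (trans (∑ℕ-cong (suc r) (λ i _ → pascal i)) (∑ℕ-+ (suc r) g h)) ⟩
  1 * f 0 + (∑ℕ (suc r) g + ∑ℕ (suc r) h)
    ≡⟨ cong (λ x → 1 * f 0 + (x + ∑ℕ (suc r) h))
         (∑ℕ-extend (suc r) g (n≤1+n r) (λ i r≤i → cong (_* f (suc i)) (k>n⇒nCk≡0 (s≤s r≤i)))) ⟩
  1 * f 0 + (∑ℕ r g + ∑ℕ (suc r) h)
    ≡⟨ sym (+-assoc (1 * f 0) (∑ℕ r g) (∑ℕ (suc r) h)) ⟩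
  (∑[ i < suc r ] (r C i) * f i) + (∑[ i < suc r ] (r C i) * f (suc i)) ∎
  where
  g h : ℕ → ℕ
  g i = (r C suc i) * f (suc i)
  h i = (r C i) * f (suc i)
  pascal : ∀ i → (suc r C suc i) * f (suc i) ≡ g i + h i
  pascal i = begin
    (suc r C suc i) * f (suc i)                  ≡⟨ cong (_* f (suc i)) (sym (nCk+nC[k+1]≡[n+1]C[k+1] r i)) ⟩
    (r C i + r C suc i) * f (suc i)              ≡⟨ *-distribʳ-+ (f (suc i)) (r C i) (r C suc i) ⟩
    (r C i) * f (suc i) + (r C suc i) * f (suc i) ≡⟨ +-comm ((r C i) * f (suc i)) _ ⟩
    (r C suc i) * f (suc i) + (r C i) * f (suc i) ∎

∑-choose-swap : ∀ n s (h : ℕ → ℕ) → (n C s) * (∑[ t < suc (n ∸ s) ] ((n ∸ s) C t) * h t)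
  ≡ ∑[ t < suc n ] (n C t) * ((n ∸ t) C s) * h t
∑-choose-swap n s h = begin
  (n C s) * (∑[ t < suc (n ∸ s) ] ((n ∸ s) C t) * h t)
    ≡⟨ ∑ℕ-*ˡ (suc (n ∸ s)) (n C s) (λ t → ((n ∸ s) C t) * h t) ⟩
  ∑[ t < suc (n ∸ s) ] (n C s) * (((n ∸ s) C t) * h t)
    ≡⟨ sym (∑ℕ-extend (suc n) (λ t → (n C s) * (((n ∸ s) C t) * h t)) (s≤s (m∸n≤m n s)) vanish) ⟩
  ∑[ t < suc n ] (n C s) * (((n ∸ s) C t) * h t)
    ≡⟨ ∑ℕ-cong (suc n) (λ t _ → trans (sym (*-assoc (n C s) _ (h t)))
                                      (cong (_* h t) (nCk*[n∸k]Cl≡nCl*[n∸l]Ck n s t))) ⟩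
  ∑[ t < suc n ] (n C t) * ((n ∸ t) C s) * h t ∎
  where
  vanish : ∀ t → suc (n ∸ s) ≤ t → (n C s) * (((n ∸ s) C t) * h t) ≡ 0
  vanish t n∸s<t rewrite k>n⇒nCk≡0 n∸s<t = *-zeroʳ (n C s)

-- The block of a new first element takes t of the n other elements and has size t + 1 ∈ T;
-- X counts the structures on the remaining n ∸ t elements.
viaFirstBlock : Subset → (ℕ → ℕ) → ℕ → ℕ
viaFirstBlock T X n = ∑[ t < suc n ] (n C t) * (⟦ T (suc t) ⟧ * X (n ∸ t))

viaFirstBlock-cong : ∀ T {X Y : ℕ → ℕ} n → (∀ m → m ≤ n → X m ≡ Y m) →
  viaFirstBlock T X n ≡ viaFirstBlock T Y n
viaFirstBlock-cong T n X≡Y = ∑ℕ-cong (suc n) (λ t _ →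
  cong (λ x → (n C t) * (⟦ T (suc t) ⟧ * x)) (X≡Y (n ∸ t) (m∸n≤m n t)))

viaFirstBlock-*ˡ : ∀ T c (X : ℕ → ℕ) n → c * viaFirstBlock T X n ≡ viaFirstBlock T (λ m → c * X m) n
viaFirstBlock-*ˡ T c X n = trans (∑ℕ-*ˡ (suc n) c (λ t → (n C t) * (⟦ T (suc t) ⟧ * X (n ∸ t))))
  (∑ℕ-cong (suc n) (λ t _ → solve 4 (λ c x y z → c :* (x :* (y :* z)) := x :* (y :* (c :* z))) refl
                                    c (n C t) ⟦ T (suc t) ⟧ (X (n ∸ t))))

viaFirstBlock-∑ : ∀ T N (X : ℕ → ℕ → ℕ) n →
  ∑[ i < N ] viaFirstBlock T (X i) n ≡ viaFirstBlock T (λ m → ∑[ i < N ] X i m) n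
viaFirstBlock-∑ T N X n = begin
  ∑[ i < N ] ∑[ t < suc n ] (n C t) * (⟦ T (suc t) ⟧ * X i (n ∸ t))
    ≡⟨ ∑ℕ-comm N (suc n) (λ i t → (n C t) * (⟦ T (suc t) ⟧ * X i (n ∸ t))) ⟩
  ∑[ t < suc n ] ∑[ i < N ] (n C t) * (⟦ T (suc t) ⟧ * X i (n ∸ t))
    ≡⟨ ∑ℕ-cong (suc n) (λ t _ → trans (sym (∑ℕ-*ˡ N (n C t) (λ i → ⟦ T (suc t) ⟧ * X i (n ∸ t))))
         (cong ((n C t) *_) (sym (∑ℕ-*ˡ N ⟦ T (suc t) ⟧ (λ i → X i (n ∸ t)))))) ⟩
  ∑[ t < suc n ] (n C t) * (⟦ T (suc t) ⟧ * (∑[ i < N ] X i (n ∸ t))) ∎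

⟦∖｛｝⟧ : ∀ T {u} x → T u ≡ true → ⟦ T x ⟧ ≡ ⟦ (T ∖｛ u ｝) x ⟧ + ⟦ x ≡ᵇ u ⟧
⟦∖｛｝⟧ T {u} x Tu≡true with x ≡ᵇ u in x≡ᵇu
... | true  rewrite ≡ᵇ⇒≡ x u (subst True (sym x≡ᵇu) _) | Tu≡true = refl
... | false = trans (cong ⟦_⟧ (sym (∧-identityʳ (T x)))) (sym (+-identityʳ _))

viaFirstBlock-remove : ∀ T a (X : ℕ → ℕ) n → T (suc a) ≡ true →
  viaFirstBlock T X n ≡ viaFirstBlock (T ∖｛ suc a ｝) X n + (n C a) * X (n ∸ a)
viaFirstBlock-remove T a X n Ta≡true = begin
  viaFirstBlock T X n
    ≡⟨ ∑ℕ-cong (suc n) (λ t _ → split t) ⟩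
  ∑[ t < suc n ] g t + ⟦ t ≡ᵇ a ⟧ * h t
    ≡⟨ ∑ℕ-+ (suc n) g (λ t → ⟦ t ≡ᵇ a ⟧ * h t) ⟩
  viaFirstBlock (T ∖｛ suc a ｝) X n + (∑[ t < suc n ] ⟦ t ≡ᵇ a ⟧ * h t)
    ≡⟨ cong (viaFirstBlock (T ∖｛ suc a ｝) X n +_)
         (∑ℕ-pick (suc n) a h (λ n<a → cong (_* X (n ∸ a)) (k>n⇒nCk≡0 n<a))) ⟩
  viaFirstBlock (T ∖｛ suc a ｝) X n + (n C a) * X (n ∸ a) ∎
  where
  g h : ℕ → ℕ
  g t = (n C t) * (⟦ (T ∖｛ suc a ｝) (suc t) ⟧ * X (n ∸ t))
  h t = (n C t) * X (n ∸ t)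
  split : ∀ t → (n C t) * (⟦ T (suc t) ⟧ * X (n ∸ t)) ≡ g t + ⟦ t ≡ᵇ a ⟧ * h t
  split t rewrite ⟦∖｛｝⟧ T (suc t) Ta≡true =
    solve 4 (λ c x y z → c :* ((x :+ y) :* z) := c :* (x :* z) :+ y :* (c :* z)) refl
      (n C t) ⟦ (T ∖｛ suc a ｝) (suc t) ⟧ ⟦ t ≡ᵇ a ⟧ (X (n ∸ t))

-- With u = suc a: used i j elements fill i labelled blocks of size a and j unlabelled blocks of
-- size u, splittings i j counts the ways to split them so (the labelled blocks one at a time, then
-- the block of the least remaining element), and multinomial n i j is the coefficient
-- n! / ((u−1)!^i u!^j j! (n−(u−1)i−uj)!) of the theorem (coeff≡multinomial).
module Multinomial (a : ℕ) where

  used : ℕ → ℕ → ℕ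
  used i j = i * a + j * suc a

  a*i+u*j≡used : ∀ i j → a * i + suc a * j ≡ used i j
  a*i+u*j≡used i j = cong₂ _+_ (*-comm a i) (*-comm (suc a) j)

  used-suc : ∀ i j → used (suc i) j ≡ a + used i j
  used-suc i j = +-assoc a (i * a) (j * suc a)

  splittings : ℕ → ℕ → ℕ
  splittings zero    zero    = 1
  splittings zero    (suc j) = ((a + used 0 j) C a) * splittings 0 j
  splittings (suc i) j       = ((a + used i j) C a) * splittings i j

  multinomial : ℕ → ℕ → ℕ → ℕ
  multinomial n i j = (n C used i j) * splittings i j

  splittings-factorial : ∀ i j → splittings i j * ((a !) ^ i * (suc a !) ^ j * j !) ≡ (used i j) !
  splittings-factorial zero zero = refl
  splittings-factorial zero (suc j) = begin
    ((a + S) C a) * splittings 0 j * (1 * (suc a ! * (suc a !) ^ j) * (suc j * j !))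
      ≡⟨ solve 7 (λ c k e f g v w → c :* k :* (con 1 :* ((v :* e) :* f) :* (w :* g))
                                   := c :* (e :* (k :* (con 1 :* f :* g))) :* (w :* v))
           refl ((a + S) C a) (splittings 0 j) (a !) ((suc a !) ^ j) (j !) (suc a) (suc j) ⟩
    ((a + S) C a) * (a ! * (splittings 0 j * ((a !) ^ 0 * (suc a !) ^ j * j !))) * (suc j * suc a)
      ≡⟨ cong (λ x → ((a + S) C a) * (a ! * x) * (suc j * suc a)) (splittings-factorial 0 j) ⟩
    ((a + S) C a) * (a ! * S !) * suc (a + S)
      ≡⟨ cong (_* suc (a + S)) ([k+l]Ck*k!l!≡[k+l]! a S) ⟩
    (a + S) ! * suc (a + S)
      ≡⟨ *-comm ((a + S) !) (suc (a + S)) ⟩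
    suc (a + S) ! ∎
    where
    S : ℕ
    S = used 0 j
    open +-*-Solver using (con)
  splittings-factorial (suc i) j = begin
    ((a + S) C a) * splittings i j * (a ! * (a !) ^ i * (suc a !) ^ j * j !)
      ≡⟨ solve 6 (λ c k e f g h → c :* k :* (e :* f :* g :* h) := c :* (e :* (k :* (f :* g :* h))))
           refl ((a + S) C a) (splittings i j) (a !) ((a !) ^ i) ((suc a !) ^ j) (j !) ⟩
    ((a + S) C a) * (a ! * (splittings i j * ((a !) ^ i * (suc a !) ^ j * j !)))
      ≡⟨ cong (λ x → ((a + S) C a) * (a ! * x)) (splittings-factorial i j) ⟩
    ((a + S) C a) * (a ! * S !)
      ≡⟨ [k+l]Ck*k!l!≡[k+l]! a S ⟩
    (a + S) !
      ≡⟨ cong _! (sym (used-suc i j)) ⟩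
    used (suc i) j ! ∎
    where
    S : ℕ
    S = used i j

  multinomial-factorial : ∀ n i j → used i j ≤ n →
    multinomial n i j * ((a !) ^ i * (suc a !) ^ j * j ! * (n ∸ used i j) !) ≡ n !
  multinomial-factorial n i j used≤n = begin
    (n C used i j) * splittings i j * (D * (n ∸ used i j) !)
      ≡⟨ solve 4 (λ c k d e → c :* k :* (d :* e) := c :* (k :* d :* e)) refl
           (n C used i j) (splittings i j) D ((n ∸ used i j) !) ⟩
    (n C used i j) * (splittings i j * D * (n ∸ used i j) !)
      ≡⟨ cong (λ x → (n C used i j) * (x * (n ∸ used i j) !)) (splittings-factorial i j) ⟩
    (n C used i j) * (used i j ! * (n ∸ used i j) !)
      ≡⟨ nCk*k![n∸k]!≡n! used≤n ⟩
    n ! ∎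
    where
    D : ℕ
    D = (a !) ^ i * (suc a !) ^ j * j !

  multinomial-zero : ∀ {n} i j → n < used i j → multinomial n i j ≡ 0
  multinomial-zero i j n<used = cong (_* splittings i j) (k>n⇒nCk≡0 n<used)

  coeff≡multinomial : ∀ n i j → used i j ≤ n → coeff n (suc a) i j ≡ multinomial n i j
  coeff≡multinomial n i j used≤n = begin
    (n ! / denom n (suc a) i j) {{denom≢0 n (suc a) i j}}
      ≡⟨ cong (λ x → (x / denom n (suc a) i j) {{denom≢0 n (suc a) i j}}) (sym M*denom≡n!) ⟩
    (multinomial n i j * denom n (suc a) i j / denom n (suc a) i j) {{denom≢0 n (suc a) i j}}
      ≡⟨ m*n/n≡m (multinomial n i j) (denom n (suc a) i j) {{denom≢0 n (suc a) i j}} ⟩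
    multinomial n i j ∎
    where
    M*denom≡n! : multinomial n i j * denom n (suc a) i j ≡ n !
    M*denom≡n! = trans
      (cong (λ x → multinomial n i j * ((a !) ^ i * (suc a !) ^ j * j ! * (n ∸ x) !)) (a*i+u*j≡used i j))
      (multinomial-factorial n i j used≤n)

  multinomial-suc : ∀ n i j → multinomial n (suc i) j ≡ (n C a) * multinomial (n ∸ a) i j
  multinomial-suc n i j = begin
    (n C used (suc i) j) * (((a + used i j) C a) * splittings i j)
      ≡⟨ cong (λ x → (n C x) * (((a + used i j) C a) * splittings i j)) (used-suc i j) ⟩
    (n C (a + used i j)) * (((a + used i j) C a) * splittings i j)
      ≡⟨ sym (*-assoc (n C (a + used i j)) _ _) ⟩
    (n C (a + used i j)) * ((a + used i j) C a) * splittings i j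
      ≡⟨ cong (_* splittings i j) (nC[k+l]*[k+l]Ck≡nCk*[n∸k]Cl n a (used i j)) ⟩
    (n C a) * ((n ∸ a) C used i j) * splittings i j
      ≡⟨ *-assoc (n C a) _ _ ⟩
    (n C a) * multinomial (n ∸ a) i j ∎

  multinomial-pascal : ∀ n j → multinomial (suc n) 0 (suc j) ≡ multinomial n 0 (suc j) + multinomial n 1 j
  multinomial-pascal n j = begin
    (suc n C suc (a + S)) * K
      ≡⟨ cong (_* K) (sym (nCk+nC[k+1]≡[n+1]C[k+1] n (a + S))) ⟩
    ((n C (a + S)) + (n C suc (a + S))) * K
      ≡⟨ *-distribʳ-+ K (n C (a + S)) _ ⟩
    (n C (a + S)) * K + (n C suc (a + S)) * K
      ≡⟨ +-comm ((n C (a + S)) * K) _ ⟩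
    multinomial n 0 (suc j) + (n C (a + S)) * K
      ≡⟨ cong (λ x → multinomial n 0 (suc j) + (n C x) * K) (sym (used-suc 0 j)) ⟩
    multinomial n 0 (suc j) + multinomial n 1 j ∎
    where
    S K : ℕ
    S = used 0 j
    K = splittings 0 (suc j)

  multinomial-∸-suc : ∀ n i j (X : ℕ → ℕ) →
    multinomial n i j * X (suc n ∸ used i j) ≡ multinomial n i j * X (suc (n ∸ used i j))
  multinomial-∸-suc n i j X with used i j ≤? n
  ... | yes used≤n = cong (λ x → multinomial n i j * X x) (+-∸-assoc 1 used≤n)
  ... | no  used≰n rewrite multinomial-zero i j (≰⇒> used≰n) = refl

  multinomial-viaFirstBlock : ∀ T (X : ℕ → ℕ) n i j →
    multinomial n i j * viaFirstBlock T X (n ∸ used i j)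
      ≡ viaFirstBlock T (λ m → multinomial m i j * X (m ∸ used i j)) n
  multinomial-viaFirstBlock T X n i j = begin
    (n C s) * K * (∑[ t < suc (n ∸ s) ] ((n ∸ s) C t) * h t)
      ≡⟨ trans (cong (_* rest) (*-comm (n C s) K)) (*-assoc K (n C s) rest) ⟩
    K * ((n C s) * (∑[ t < suc (n ∸ s) ] ((n ∸ s) C t) * h t))
      ≡⟨ cong (K *_) (∑-choose-swap n s h) ⟩
    K * (∑[ t < suc n ] (n C t) * ((n ∸ t) C s) * h t)
      ≡⟨ ∑ℕ-*ˡ (suc n) K (λ t → (n C t) * ((n ∸ t) C s) * h t) ⟩
    ∑[ t < suc n ] K * ((n C t) * ((n ∸ t) C s) * h t)
      ≡⟨ ∑ℕ-cong (suc n) (λ t _ → rearrange t) ⟩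
    viaFirstBlock T (λ m → multinomial m i j * X (m ∸ s)) n ∎
    where
    s K rest : ℕ
    s = used i j
    K = splittings i j
    rest = viaFirstBlock T X (n ∸ s)
    h : ℕ → ℕ
    h t = ⟦ T (suc t) ⟧ * X (n ∸ s ∸ t)
    rearrange : ∀ t → K * ((n C t) * ((n ∸ t) C s) * h t)
      ≡ (n C t) * (⟦ T (suc t) ⟧ * (((n ∸ t) C s) * K * X (n ∸ t ∸ s)))
    rearrange t rewrite m∸n∸o≡m∸o∸n n s t =
      solve 5 (λ k c d b x → k :* (c :* d :* (b :* x)) := c :* (b :* (d :* k :* x))) refl
        K (n C t) ((n ∸ t) C s) ⟦ T (suc t) ⟧ (X (n ∸ t ∸ s))

∑Vec : (m b : ℕ) → (Vec (Fin b) m → ℕ) → ℕ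
∑Vec zero    b f = f []
∑Vec (suc m) b f = sum {b} (λ x → ∑Vec m b (λ v → f (x ∷ v)))

∑Vec-cong : ∀ m b {f g : Vec (Fin b) m → ℕ} → (∀ v → f v ≡ g v) → ∑Vec m b f ≡ ∑Vec m b g
∑Vec-cong zero    b f≡g = f≡g []
∑Vec-cong (suc m) b f≡g = sum-cong-≗ {b} (λ x → ∑Vec-cong m b (λ v → f≡g (x ∷ v)))

∑Vec-zero : ∀ m b → ∑Vec m b (λ _ → 0) ≡ 0
∑Vec-zero zero    b = refl
∑Vec-zero (suc m) b = trans (sum-cong-≗ {b} (λ _ → ∑Vec-zero m b)) (sum-replicate-zero b)

∑Vec-*ˡ : ∀ m b c (f : Vec (Fin b) m → ℕ) → c * ∑Vec m b f ≡ ∑Vec m b (λ v → c * f v)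
∑Vec-*ˡ zero    b c f = refl
∑Vec-*ˡ (suc m) b c f =
  trans (*-distribˡ-sum {b} c _) (sum-cong-≗ {b} (λ x → ∑Vec-*ˡ m b c (λ v → f (x ∷ v))))

sumList-map-concatMap : ∀ {A B : Set} (f : B → ℕ) (g : A → List B) xs →
  sumList (map f (concatMap g xs)) ≡ sumList (map (λ x → sumList (map f (g x))) xs)
sumList-map-concatMap f g []       = refl
sumList-map-concatMap f g (x ∷ xs) = begin
  sumList (map f (g x ++ concatMap g xs))
    ≡⟨ cong sumList (map-++ f (g x) (concatMap g xs)) ⟩
  sumList (map f (g x) ++ map f (concatMap g xs))
    ≡⟨ sumList-++ (map f (g x)) _ ⟩
  sumList (map f (g x)) + sumList (map f (concatMap g xs))
    ≡⟨ cong (sumList (map f (g x)) +_) (sumList-map-concatMap f g xs) ⟩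
  sumList (map (λ y → sumList (map f (g y))) (x ∷ xs)) ∎

sumList-tabulate : ∀ b (f : Fin b → ℕ) → sumList (tabulate f) ≡ sum f
sumList-tabulate zero    f = refl
sumList-tabulate (suc b) f = cong (f fzero +_) (sumList-tabulate b (f ∘ fsuc))

sumList-map-allVecs : ∀ m b (f : Vec (Fin b) m → ℕ) → sumList (map f (allVecs m b)) ≡ ∑Vec m b f
sumList-map-allVecs zero    b f = +-identityʳ (f [])
sumList-map-allVecs (suc m) b f = begin
  sumList (map f (concatMap (λ x → map (x ∷_) (allVecs m b)) (allFin b)))
    ≡⟨ sumList-map-concatMap f (λ x → map (x ∷_) (allVecs m b)) (allFin b) ⟩
  sumList (map (λ x → sumList (map f (map (x ∷_) (allVecs m b)))) (allFin b))
    ≡⟨ cong sumList (map-cong (λ x → trans (cong sumList (sym (map-∘ (allVecs m b))))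
                                           (sumList-map-allVecs m b (λ v → f (x ∷ v)))) (allFin b)) ⟩
  sumList (map (λ x → ∑Vec m b (λ v → f (x ∷ v))) (allFin b))
    ≡⟨ trans (cong sumList (map-tabulate {n = b} id g)) (sumList-tabulate b g) ⟩
  ∑Vec (suc m) b f ∎
  where
  g : Fin b → ℕ
  g x = ∑Vec m b (λ v → f (x ∷ v))

length-filterᵇ : ∀ {A : Set} (p : A → Bool) xs → length (filterᵇ p xs) ≡ sumList (map (⟦_⟧ ∘ p) xs)
length-filterᵇ p []       = refl
length-filterᵇ p (x ∷ xs) with p x
... | true  = cong suc (length-filterᵇ p xs)
... | false = length-filterᵇ p xs

length-filterᵇ-allVecs : ∀ m b (p : Vec (Fin b) m → Bool) →
  length (filterᵇ p (allVecs m b)) ≡ ∑Vec m b (λ v → ⟦ p v ⟧)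
length-filterᵇ-allVecs m b p = trans (length-filterᵇ p (allVecs m b)) (sumList-map-allVecs m b (⟦_⟧ ∘ p))

∑Bools : (m : ℕ) → (Vec Bool m → ℕ) → ℕ
∑Bools zero    g = g []
∑Bools (suc m) g = ∑Bools m (λ s → g (true ∷ s)) + ∑Bools m (λ s → g (false ∷ s))

∑Bools-cong : ∀ m {g h : Vec Bool m → ℕ} → (∀ s → g s ≡ h s) → ∑Bools m g ≡ ∑Bools m h
∑Bools-cong zero    g≡h = g≡h []
∑Bools-cong (suc m) g≡h =
  cong₂ _+_ (∑Bools-cong m (g≡h ∘ (true ∷_))) (∑Bools-cong m (g≡h ∘ (false ∷_)))

∑Bools-zero : ∀ m → ∑Bools m (λ _ → 0) ≡ 0
∑Bools-zero zero    = refl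
∑Bools-zero (suc m) = cong₂ _+_ (∑Bools-zero m) (∑Bools-zero m)

∑-∑Bools-comm : ∀ b m (g : Fin b → Vec Bool m → ℕ) →
  sum {b} (λ y → ∑Bools m (g y)) ≡ ∑Bools m (λ s → sum {b} (λ y → g y s))
∑-∑Bools-comm b zero    g = refl
∑-∑Bools-comm b (suc m) g = trans (∑-distrib-+ {b} _ _)
  (cong₂ _+_ (∑-∑Bools-comm b m (λ y s → g y (true ∷ s))) (∑-∑Bools-comm b m (λ y s → g y (false ∷ s))))

trues : ∀ {m} → Vec Bool m → ℕ
trues []          = 0
trues (true  ∷ s) = suc (trues s)
trues (false ∷ s) = trues s

falses : ∀ {m} → Vec Bool m → ℕ
falses []          = 0
falses (true  ∷ s) = falses s
falses (false ∷ s) = suc (falses s)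

falses≡m∸trues : ∀ {m} (s : Vec Bool m) → falses s ≡ m ∸ trues s
falses≡m∸trues []          = refl
falses≡m∸trues (true  ∷ s) = falses≡m∸trues s
falses≡m∸trues (false ∷ s) = trans (cong suc (falses≡m∸trues s)) (sym (+-∸-assoc 1 (trues≤m s)))
  where
  trues≤m : ∀ {m} (s : Vec Bool m) → trues s ≤ m
  trues≤m []          = z≤n
  trues≤m (true  ∷ s) = s≤s (trues≤m s)
  trues≤m (false ∷ s) = m≤n⇒m≤1+n (trues≤m s)

∑Bools-trues : ∀ n (g : ℕ → ℕ) → ∑Bools n (λ s → g (trues s)) ≡ ∑[ t < suc n ] (n C t) * g t
∑Bools-trues zero    g = sym (trans (+-identityʳ (g 0 + 0)) (+-identityʳ (g 0)))
∑Bools-trues (suc n) g = begin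
  ∑Bools n (λ s → g (suc (trues s))) + ∑Bools n (λ s → g (trues s))
    ≡⟨ +-comm (∑Bools n (λ s → g (suc (trues s)))) _ ⟩
  ∑Bools n (λ s → g (trues s)) + ∑Bools n (λ s → g (suc (trues s)))
    ≡⟨ cong₂ _+_ (∑Bools-trues n g) (∑Bools-trues n (g ∘ suc)) ⟩
  (∑[ t < suc n ] (n C t) * g t) + (∑[ t < suc n ] (n C t) * g (suc t))
    ≡⟨ sym (∑-pascal n g) ⟩
  ∑[ t < suc (suc n) ] (suc n C t) * g t ∎

prefixFalse : ∀ {m} → ℕ → Vec Bool m → Bool
prefixFalse zero    s           = true
prefixFalse (suc r) []          = true
prefixFalse (suc r) (true  ∷ s) = false
prefixFalse (suc r) (false ∷ s) = prefixFalse r s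

∑Bools-prefixFalse : ∀ r n (g : ℕ → ℕ) →
  ∑Bools (r + n) (λ s → ⟦ prefixFalse r s ⟧ * g (trues s)) ≡ ∑[ t < suc n ] (n C t) * g t
∑Bools-prefixFalse zero    n g = trans (∑Bools-cong n (λ s → +-identityʳ (g (trues s)))) (∑Bools-trues n g)
∑Bools-prefixFalse (suc r) n g =
  trans (cong (_+ ∑Bools (r + n) (λ s → ⟦ prefixFalse r s ⟧ * g (trues s))) (∑Bools-zero (r + n)))
        (∑Bools-prefixFalse r n g)

merge : ∀ {m b} (s : Vec Bool m) → Vec (Fin b) (falses s) → Vec (Fin (suc b)) m
merge []          []      = []
merge (true  ∷ s) w       = fzero ∷ merge s w
merge (false ∷ s) (y ∷ w) = fsuc y ∷ merge s w

∑Vec-merge : ∀ m b (f : Vec (Fin (suc b)) m → ℕ) →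
  ∑Vec m (suc b) f ≡ ∑Bools m (λ s → ∑Vec (falses s) b (λ w → f (merge s w)))
∑Vec-merge zero    b f = refl
∑Vec-merge (suc m) b f = cong₂ _+_ (∑Vec-merge m b (λ v → f (fzero ∷ v)))
  (trans (sum-cong-≗ {b} (λ y → ∑Vec-merge m b (λ v → f (fsuc y ∷ v))))
         (∑-∑Bools-comm b m (λ y s → ∑Vec (falses s) b (λ w → f (fsuc y ∷ merge s w)))))

labels : ∀ {m b} → Vec (Fin b) m → List ℕ
labels v = map toℕ (toList v)

rgsFrom-merge : ∀ {m b} k (s : Vec Bool m) (w : Vec (Fin b) (falses s)) →
  rgsFrom (suc k) (labels (merge s w)) ≡ rgsFrom k (labels w)
rgsFrom-merge k []          []      = refl
rgsFrom-merge k (true  ∷ s) w       rewrite ⊔-identityʳ k = rgsFrom-merge k s w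
rgsFrom-merge k (false ∷ s) (y ∷ w) = cong ((toℕ y <ᵇ suc k) ∧_) (rgsFrom-merge (k ⊔ suc (toℕ y)) s w)

⌊suc≟suc⌋ : ∀ {b} (x y : Fin b) → ⌊ fsuc x ≟ fsuc y ⌋ ≡ ⌊ x ≟ y ⌋
⌊suc≟suc⌋ x y with x ≟ y
... | yes _ = refl
... | no  _ = refl

blockSize-merge-zero : ∀ {m b} (s : Vec Bool m) (w : Vec (Fin b) (falses s)) →
  blockSize (merge s w) fzero ≡ trues s
blockSize-merge-zero []          []      = refl
blockSize-merge-zero (true  ∷ s) w       = cong suc (blockSize-merge-zero s w)
blockSize-merge-zero (false ∷ s) (y ∷ w) = blockSize-merge-zero s w

blockSize-merge-suc : ∀ {m b} (s : Vec Bool m) (w : Vec (Fin b) (falses s)) j →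
  blockSize (merge s w) (fsuc j) ≡ blockSize w j
blockSize-merge-suc []          []      j = refl
blockSize-merge-suc (true  ∷ s) w       j = blockSize-merge-suc s w j
blockSize-merge-suc (false ∷ s) (y ∷ w) j with y ≟ j
... | yes _ = cong suc (blockSize-merge-suc s w j)
... | no  _ = blockSize-merge-suc s w j

allB-tabulate-cong : ∀ {A B : Set} n (p : A → Bool) (q : B → Bool) (f : Fin n → A) (g : Fin n → B) →
  (∀ i → p (f i) ≡ q (g i)) → allB p (tabulate f) ≡ allB q (tabulate g)
allB-tabulate-cong zero    p q f g pf≡qg = refl
allB-tabulate-cong (suc n) p q f g pf≡qg =
  cong₂ _∧_ (pf≡qg fzero) (allB-tabulate-cong n p q (f ∘ fsuc) (g ∘ fsuc) (pf≡qg ∘ fsuc))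

blocksOK-merge : ∀ {m b} T (s : Vec Bool m) (w : Vec (Fin b) (falses s)) →
  blocksOK T (fzero ∷ merge s w) ≡ T (suc (trues s)) ∧ blocksOK T w
blocksOK-merge {b = b} T s w = cong₂ _∧_
  (cong (λ k → T (suc k)) (blockSize-merge-zero s w))
  (allB-tabulate-cong b _ _ fsuc id (λ j → cong (λ k → (1 ≤ᵇ k) ∧ T k) (blockSize-merge-suc s w j)))

take-merge : ∀ {m b} r (s : Vec Bool m) (w : Vec (Fin b) (falses s)) → prefixFalse r s ≡ true →
  take r (toList (merge s w)) ≡ map fsuc (take r (toList w))
take-merge zero    s           w       _  = refl
take-merge (suc r) []          []      _  = refl
take-merge (suc r) (false ∷ s) (y ∷ w) pf = cong (fsuc y ∷_) (take-merge r s w pf)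

allB-≢zero-merge : ∀ {m b} r (s : Vec Bool m) (w : Vec (Fin b) (falses s)) → prefixFalse r s ≡ false →
  allB (λ y → not ⌊ fzero ≟ y ⌋) (take r (toList (merge s w))) ≡ false
allB-≢zero-merge (suc r) (true  ∷ s) w       _  = refl
allB-≢zero-merge (suc r) (false ∷ s) (y ∷ w) pf = allB-≢zero-merge r s w pf

allB-≢zero-map-suc : ∀ {b} (xs : List (Fin b)) → allB (λ y → not ⌊ fzero ≟ y ⌋) (map fsuc xs) ≡ true
allB-≢zero-map-suc []       = refl
allB-≢zero-map-suc (x ∷ xs) = allB-≢zero-map-suc xs

allDistinct-map-suc : ∀ {b} (xs : List (Fin b)) → allDistinct (map fsuc xs) ≡ allDistinct xs
allDistinct-map-suc []       = refl
allDistinct-map-suc (x ∷ xs) = cong₂ _∧_ (allB-≢-map-suc xs) (allDistinct-map-suc xs)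
  where
  allB-≢-map-suc : ∀ ys →
    allB (λ y → not ⌊ fsuc x ≟ y ⌋) (map fsuc ys) ≡ allB (λ y → not ⌊ x ≟ y ⌋) ys
  allB-≢-map-suc []       = refl
  allB-≢-map-suc (y ∷ ys) = cong₂ _∧_ (cong not (⌊suc≟suc⌋ x y)) (allB-≢-map-suc ys)

firstDistinct-merge : ∀ {m b} r (s : Vec Bool m) (w : Vec (Fin b) (falses s)) →
  firstDistinct (suc r) (fzero ∷ merge s w) ≡ prefixFalse r s ∧ firstDistinct r w
firstDistinct-merge r s w with prefixFalse r s in pf
... | true  rewrite take-merge r s w pf =
  cong₂ _∧_ (allB-≢zero-map-suc (take r (toList w))) (allDistinct-map-suc (take r (toList w)))
... | false rewrite allB-≢zero-merge r s w pf = refl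

isRTPartition-merge : ∀ {m b} T r (s : Vec Bool m) (w : Vec (Fin b) (falses s)) →
  isRTPartition T (suc r) (fzero ∷ merge s w) ≡ (prefixFalse r s ∧ T (suc (trues s))) ∧ isRTPartition T r w
isRTPartition-merge T r s w = begin
  isRGS (fzero ∷ merge s w) ∧ blocksOK T (fzero ∷ merge s w) ∧ firstDistinct (suc r) (fzero ∷ merge s w)
    ≡⟨ cong₂ _∧_ (rgsFrom-merge 0 s w) (cong₂ _∧_ (blocksOK-merge T s w) (firstDistinct-merge r s w)) ⟩
  isRGS w ∧ (T (suc (trues s)) ∧ blocksOK T w) ∧ (prefixFalse r s ∧ firstDistinct r w)
    ≡⟨ ∧-Solver.solve 5 (λ x t y f z → x ⊕ ((t ⊕ y) ⊕ (f ⊕ z)) ⊜ (f ⊕ t) ⊕ (x ⊕ (y ⊕ z))) refl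
         (isRGS w) (T (suc (trues s))) (blocksOK T w) (prefixFalse r s) (firstDistinct r w) ⟩
  (prefixFalse r s ∧ T (suc (trues s))) ∧ isRTPartition T r w ∎
  where
  module ∧-Solver = Algebra.Solver.CommutativeMonoid ∧-commutativeMonoid
  open ∧-Solver using (_⊕_; _⊜_)

countRT : Subset → ℕ → (m b : ℕ) → ℕ
countRT T r m b = ∑Vec m b (λ v → ⟦ isRTPartition T r v ⟧)

stirlingTR≡countRT : ∀ T n k r → stirlingTR T n k r ≡ countRT T r (n + r) (k + r)
stirlingTR≡countRT T n k r = length-filterᵇ-allVecs (n + r) (k + r) (isRTPartition T r)

-- A restricted growth string starts with label 0; s marks the later positions in block 0, which
-- must avoid the other r distinguished positions, and w is a restricted growth string on the rest.
countRT-removeFirstBlock : ∀ T r m b → countRT T (suc r) (suc m) (suc b)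
  ≡ ∑Bools m (λ s → ⟦ prefixFalse r s ⟧ * (⟦ T (suc (trues s)) ⟧ * countRT T r (falses s) b))
countRT-removeFirstBlock T r m b = begin
  ∑Vec m (suc b) (λ v → ⟦ P (fzero ∷ v) ⟧) + sum {b} (λ y → ∑Vec m (suc b) (λ v → ⟦ P (fsuc y ∷ v) ⟧))
    ≡⟨ cong (∑Vec m (suc b) (λ v → ⟦ P (fzero ∷ v) ⟧) +_)
         (trans (sum-cong-≗ {b} (λ _ → ∑Vec-zero m (suc b))) (sum-replicate-zero b)) ⟩
  ∑Vec m (suc b) (λ v → ⟦ P (fzero ∷ v) ⟧) + 0
    ≡⟨ +-identityʳ _ ⟩
  ∑Vec m (suc b) (λ v → ⟦ P (fzero ∷ v) ⟧)
    ≡⟨ ∑Vec-merge m b (λ v → ⟦ P (fzero ∷ v) ⟧) ⟩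
  ∑Bools m (λ s → ∑Vec (falses s) b (λ w → ⟦ P (fzero ∷ merge s w) ⟧))
    ≡⟨ ∑Bools-cong m factor ⟩
  ∑Bools m (λ s → ⟦ prefixFalse r s ⟧ * (⟦ T (suc (trues s)) ⟧ * countRT T r (falses s) b)) ∎
  where
  P : ∀ {m b} → Vec (Fin b) m → Bool
  P = isRTPartition T (suc r)
  factor : ∀ s → ∑Vec (falses s) b (λ w → ⟦ P (fzero ∷ merge s w) ⟧)
    ≡ ⟦ prefixFalse r s ⟧ * (⟦ T (suc (trues s)) ⟧ * countRT T r (falses s) b)
  factor s = begin
    ∑Vec (falses s) b (λ w → ⟦ P (fzero ∷ merge s w) ⟧)
      ≡⟨ ∑Vec-cong (falses s) b (λ w → trans (cong ⟦_⟧ (isRTPartition-merge T r s w))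
                                             (⟦∧⟧ (prefixFalse r s ∧ T (suc (trues s))) _)) ⟩
    ∑Vec (falses s) b (λ w → ⟦ prefixFalse r s ∧ T (suc (trues s)) ⟧ * ⟦ isRTPartition T r w ⟧)
      ≡⟨ sym (∑Vec-*ˡ (falses s) b ⟦ prefixFalse r s ∧ T (suc (trues s)) ⟧ _) ⟩
    ⟦ prefixFalse r s ∧ T (suc (trues s)) ⟧ * countRT T r (falses s) b
      ≡⟨ trans (cong (_* N) (⟦∧⟧ (prefixFalse r s) (T (suc (trues s))))) (*-assoc ⟦ prefixFalse r s ⟧ _ N) ⟩
    ⟦ prefixFalse r s ⟧ * (⟦ T (suc (trues s)) ⟧ * countRT T r (falses s) b) ∎
    where
    N : ℕ
    N = countRT T r (falses s) b

stirlingTR-recurrence : ∀ T n k r → stirlingTR T n k (suc r) ≡ viaFirstBlock T (λ m → stirlingTR T m k r) n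
stirlingTR-recurrence T n k r = begin
  stirlingTR T n k (suc r)
    ≡⟨ stirlingTR≡countRT T n k (suc r) ⟩
  countRT T (suc r) (n + suc r) (k + suc r)
    ≡⟨ cong₂ (countRT T (suc r)) (trans (+-suc n r) (cong suc (+-comm n r))) (+-suc k r) ⟩
  countRT T (suc r) (suc (r + n)) (suc (k + r))
    ≡⟨ countRT-removeFirstBlock T r (r + n) (k + r) ⟩
  ∑Bools (r + n) (λ s → ⟦ prefixFalse r s ⟧ * (⟦ T (suc (trues s)) ⟧ * count (falses s)))
    ≡⟨ ∑Bools-cong (r + n) (λ s → cong (λ x → ⟦ prefixFalse r s ⟧ * (⟦ T (suc (trues s)) ⟧ * count x))
                                       (falses≡m∸trues s)) ⟩
  ∑Bools (r + n) (λ s → ⟦ prefixFalse r s ⟧ * (⟦ T (suc (trues s)) ⟧ * count (r + n ∸ trues s)))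
    ≡⟨ ∑Bools-prefixFalse r n (λ t → ⟦ T (suc t) ⟧ * count (r + n ∸ t)) ⟩
  ∑[ t < suc n ] (n C t) * (⟦ T (suc t) ⟧ * count (r + n ∸ t))
    ≡⟨ ∑ℕ-cong (suc n) (λ t t<1+n → cong (λ x → (n C t) * (⟦ T (suc t) ⟧ * x))
                                         (count≡stirlingTR t (≤-pred t<1+n))) ⟩
  viaFirstBlock T (λ m → stirlingTR T m k r) n ∎
  where
  count : ℕ → ℕ
  count m = countRT T r m (k + r)
  count≡stirlingTR : ∀ t → t ≤ n → count (r + n ∸ t) ≡ stirlingTR T (n ∸ t) k r
  count≡stirlingTR t t≤n = begin
    count (r + n ∸ t)   ≡⟨ cong count (trans (+-∸-assoc r t≤n) (+-comm r (n ∸ t))) ⟩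
    count (n ∸ t + r)   ≡⟨ sym (stirlingTR≡countRT T (n ∸ t) k r) ⟩
    stirlingTR T (n ∸ t) k r ∎

firstDistinct-one : ∀ {m b} (v : Vec (Fin b) m) → firstDistinct 1 v ≡ true
firstDistinct-one []      = refl
firstDistinct-one (x ∷ v) = refl

stirlingTR-shift : ∀ T n k → stirlingTR T (suc n) (suc k) 0 ≡ stirlingTR T n k 1
stirlingTR-shift T n k = begin
  stirlingTR T (suc n) (suc k) 0
    ≡⟨ stirlingTR≡countRT T (suc n) (suc k) 0 ⟩
  countRT T 0 (suc n + 0) (suc k + 0)
    ≡⟨ ∑Vec-cong (suc n + 0) (suc k + 0)
         (λ v → cong (λ x → ⟦ isRGS v ∧ blocksOK T v ∧ x ⟧) (sym (firstDistinct-one v))) ⟩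
  countRT T 1 (suc n + 0) (suc k + 0)
    ≡⟨ cong₂ (countRT T 1) (suc+0≡+1 n) (suc+0≡+1 k) ⟩
  countRT T 1 (n + 1) (k + 1)
    ≡⟨ sym (stirlingTR≡countRT T n k 1) ⟩
  stirlingTR T n k 1 ∎
  where
  suc+0≡+1 : ∀ m → suc m + 0 ≡ m + 1
  suc+0≡+1 m = trans (+-identityʳ (suc m)) (+-comm 1 m)

stirlingTR-empty : ∀ T k → stirlingTR T 0 k 0 ≡ ⟦ k ≡ᵇ 0 ⟧
stirlingTR-empty T zero    = refl
stirlingTR-empty T (suc k) = refl

module Formula (S : Subset) (a : ℕ) (Su≡true : S (suc a) ≡ true) where

  open Multinomial a

  S∖u : Subset
  S∖u = S ∖｛ suc a ｝

  P Q : ℕ → ℕ → ℕ → ℕ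
  P = stirlingTR S
  Q = stirlingTR S∖u

  cell : ℕ → ℕ → ℕ → ℕ → ℕ → ℕ
  cell n k r i j = multinomial n i j * Q (n ∸ used i j) (k ∸ j) (r ∸ i)

  row : ℕ → ℕ → ℕ → ℕ → ℕ
  row n k r i = ∑[ j < suc k ] cell n k r i j

  rhs : ℕ → ℕ → ℕ → ℕ
  rhs n k r = ∑[ i < suc r ] (r C i) * row n k r i

  row-suc-r : ∀ n k r i → i ≤ r → row n k (suc r) i ≡ viaFirstBlock S∖u (λ m → row m k r i) n
  row-suc-r n k r i i≤r = begin
    row n k (suc r) i
      ≡⟨ ∑ℕ-cong (suc k) (λ j _ → cong (multinomial n i j *_) (trans
           (cong (Q (n ∸ used i j) (k ∸ j)) (+-∸-assoc 1 i≤r))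
           (stirlingTR-recurrence S∖u (n ∸ used i j) (k ∸ j) (r ∸ i)))) ⟩
    ∑[ j < suc k ] multinomial n i j * viaFirstBlock S∖u (λ m → Q m (k ∸ j) (r ∸ i)) (n ∸ used i j)
      ≡⟨ ∑ℕ-cong (suc k) (λ j _ → multinomial-viaFirstBlock S∖u (λ m → Q m (k ∸ j) (r ∸ i)) n i j) ⟩
    ∑[ j < suc k ] viaFirstBlock S∖u (λ m → cell m k r i j) n
      ≡⟨ viaFirstBlock-∑ S∖u (suc k) (λ j m → cell m k r i j) n ⟩
    viaFirstBlock S∖u (λ m → row m k r i) n ∎

  cell-suc-i : ∀ n k r i j → cell n k (suc r) (suc i) j ≡ (n C a) * cell (n ∸ a) k r i j
  cell-suc-i n k r i j = begin
    multinomial n (suc i) j * Q (n ∸ used (suc i) j) (k ∸ j) (r ∸ i)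
      ≡⟨ cong₂ (λ x y → x * Q y (k ∸ j) (r ∸ i))
           (multinomial-suc n i j) (trans (cong (n ∸_) (used-suc i j)) (sym (∸-+-assoc n a (used i j)))) ⟩
    (n C a) * multinomial (n ∸ a) i j * Q (n ∸ a ∸ used i j) (k ∸ j) (r ∸ i)
      ≡⟨ *-assoc (n C a) (multinomial (n ∸ a) i j) (Q (n ∸ a ∸ used i j) (k ∸ j) (r ∸ i)) ⟩
    (n C a) * cell (n ∸ a) k r i j ∎

  row-suc-i : ∀ n k r i → row n k (suc r) (suc i) ≡ (n C a) * row (n ∸ a) k r i
  row-suc-i n k r i = trans (∑ℕ-cong (suc k) (λ j _ → cell-suc-i n k r i j))
                            (sym (∑ℕ-*ˡ (suc k) (n C a) (cell (n ∸ a) k r i)))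

  rhs-recurrence : ∀ n k r →
    rhs n k (suc r) ≡ viaFirstBlock S∖u (λ m → rhs m k r) n + (n C a) * rhs (n ∸ a) k r
  rhs-recurrence n k r = begin
    rhs n k (suc r)
      ≡⟨ ∑-pascal r (row n k (suc r)) ⟩
    (∑[ i < suc r ] (r C i) * row n k (suc r) i) + (∑[ i < suc r ] (r C i) * row n k (suc r) (suc i))
      ≡⟨ cong₂ _+_ (∑ℕ-cong (suc r) (λ i i<1+r → cong ((r C i) *_) (row-suc-r n k r i (≤-pred i<1+r))))
                   (∑ℕ-cong (suc r) (λ i _ → cong ((r C i) *_) (row-suc-i n k r i))) ⟩
    (∑[ i < suc r ] (r C i) * viaFirstBlock S∖u (λ m → row m k r i) n)
      + (∑[ i < suc r ] (r C i) * ((n C a) * row (n ∸ a) k r i))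
      ≡⟨ cong₂ _+_ (trans (∑ℕ-cong (suc r) (λ i _ → viaFirstBlock-*ˡ S∖u (r C i) (λ m → row m k r i) n))
                          (viaFirstBlock-∑ S∖u (suc r) (λ i m → (r C i) * row m k r i) n))
                   (trans (∑ℕ-cong (suc r) (λ i _ → x*[y*z]≡y*[x*z] (r C i) (n C a) (row (n ∸ a) k r i)))
                          (sym (∑ℕ-*ˡ (suc r) (n C a) (λ i → (r C i) * row (n ∸ a) k r i)))) ⟩
    viaFirstBlock S∖u (λ m → rhs m k r) n + (n C a) * rhs (n ∸ a) k r ∎
    where
    x*[y*z]≡y*[x*z] : ∀ x y z → x * (y * z) ≡ y * (x * z)
    x*[y*z]≡y*[x*z] x y z = solve 3 (λ x y z → x :* (y :* z) := y :* (x :* z)) refl x y z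

  rhs-zero : ∀ n k → rhs n k 0 ≡ row n k 0 0
  rhs-zero n k = trans (+-identityʳ (1 * row n k 0 0)) (*-identityˡ (row n k 0 0))

  rhs-one : ∀ n k → rhs n k 1 ≡ row n k 1 0 + row n k 1 1
  rhs-one n k = cong₂ _+_ (*-identityˡ (row n k 1 0))
    (trans (+-identityʳ (1 * row n k 1 1)) (*-identityˡ (row n k 1 1)))

  rhs-empty : ∀ k → rhs 0 k 0 ≡ Q 0 k 0
  rhs-empty k = begin
    rhs 0 k 0                       ≡⟨ rhs-zero 0 k ⟩
    1 * Q 0 k 0 + (∑[ j < k ] 0)    ≡⟨ cong (1 * Q 0 k 0 +_) (sum-replicate-zero k) ⟩
    1 * Q 0 k 0 + 0                 ≡⟨ trans (+-identityʳ (1 * Q 0 k 0)) (*-identityˡ (Q 0 k 0)) ⟩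
    Q 0 k 0                         ∎

  row-shift : ∀ n k → ∑[ j < suc (suc k) ] multinomial n 0 j * Q (suc n ∸ used 0 j) (suc k ∸ j) 0 ≡ row n k 1 0
  row-shift n k = begin
    ∑[ j < suc (suc k) ] g j
      ≡⟨ ∑ℕ-last (suc k) g ⟩
    (∑[ j < suc k ] g j) + g (suc k)
      ≡⟨ cong₂ _+_ (∑ℕ-cong (suc k) (λ j j<1+k → g-shift j (≤-pred j<1+k))) g-last ⟩
    row n k 1 0 + 0
      ≡⟨ +-identityʳ (row n k 1 0) ⟩
    row n k 1 0 ∎
    where
    g : ℕ → ℕ
    g j = multinomial n 0 j * Q (suc n ∸ used 0 j) (suc k ∸ j) 0
    g-shift : ∀ j → j ≤ k → g j ≡ cell n k 1 0 j
    g-shift j j≤k = begin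
      multinomial n 0 j * Q (suc n ∸ used 0 j) (suc k ∸ j) 0
        ≡⟨ multinomial-∸-suc n 0 j (λ m → Q m (suc k ∸ j) 0) ⟩
      multinomial n 0 j * Q (suc (n ∸ used 0 j)) (suc k ∸ j) 0
        ≡⟨ cong (λ x → multinomial n 0 j * Q (suc (n ∸ used 0 j)) x 0) (+-∸-assoc 1 j≤k) ⟩
      multinomial n 0 j * Q (suc (n ∸ used 0 j)) (suc (k ∸ j)) 0
        ≡⟨ cong (multinomial n 0 j *_) (stirlingTR-shift S∖u (n ∸ used 0 j) (k ∸ j)) ⟩
      multinomial n 0 j * Q (n ∸ used 0 j) (k ∸ j) 1 ∎
    g-last : g (suc k) ≡ 0
    g-last = begin
      multinomial n 0 (suc k) * Q (suc n ∸ used 0 (suc k)) (k ∸ k) 0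
        ≡⟨ multinomial-∸-suc n 0 (suc k) (λ m → Q m (k ∸ k) 0) ⟩
      multinomial n 0 (suc k) * Q (suc (n ∸ used 0 (suc k))) (k ∸ k) 0
        ≡⟨ cong (λ x → multinomial n 0 (suc k) * Q (suc (n ∸ used 0 (suc k))) x 0) (n∸n≡0 k) ⟩
      multinomial n 0 (suc k) * 0
        ≡⟨ *-zeroʳ (multinomial n 0 (suc k)) ⟩
      0 ∎

  -- By multinomial-pascal the new element either stays outside the chosen blocks or lies in a block
  -- of size u, whose other u − 1 elements form the block of size u − 1 of the distinguished element.
  rhs-shift : ∀ n k → rhs (suc n) (suc k) 0 ≡ rhs n k 1
  rhs-shift n k = begin
    rhs (suc n) (suc k) 0
      ≡⟨ rhs-zero (suc n) (suc k) ⟩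
    1 * Q (suc n) (suc k) 0 + (∑[ j < suc k ] multinomial (suc n) 0 (suc j) * Q (n ∸ (a + used 0 j)) (k ∸ j) 0)
      ≡⟨ cong (1 * Q (suc n) (suc k) 0 +_)
           (trans (∑ℕ-cong (suc k) (λ j _ → pascal j)) (∑ℕ-+ (suc k) A (cell n k 1 1))) ⟩
    1 * Q (suc n) (suc k) 0 + (∑ℕ (suc k) A + row n k 1 1)
      ≡⟨ sym (+-assoc (1 * Q (suc n) (suc k) 0) (∑ℕ (suc k) A) (row n k 1 1)) ⟩
    (∑[ j < suc (suc k) ] multinomial n 0 j * Q (suc n ∸ used 0 j) (suc k ∸ j) 0) + row n k 1 1
      ≡⟨ cong (_+ row n k 1 1) (row-shift n k) ⟩
    row n k 1 0 + row n k 1 1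
      ≡⟨ sym (rhs-one n k) ⟩
    rhs n k 1 ∎
    where
    A : ℕ → ℕ
    A j = multinomial n 0 (suc j) * Q (n ∸ (a + used 0 j)) (k ∸ j) 0
    pascal : ∀ j → multinomial (suc n) 0 (suc j) * Q (n ∸ (a + used 0 j)) (k ∸ j) 0 ≡ A j + cell n k 1 1 j
    pascal j = begin
      multinomial (suc n) 0 (suc j) * Q (n ∸ (a + used 0 j)) (k ∸ j) 0
        ≡⟨ cong (_* Q (n ∸ (a + used 0 j)) (k ∸ j) 0) (multinomial-pascal n j) ⟩
      (multinomial n 0 (suc j) + multinomial n 1 j) * Q (n ∸ (a + used 0 j)) (k ∸ j) 0
        ≡⟨ *-distribʳ-+ (Q (n ∸ (a + used 0 j)) (k ∸ j) 0) (multinomial n 0 (suc j)) (multinomial n 1 j) ⟩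
      A j + multinomial n 1 j * Q (n ∸ (a + used 0 j)) (k ∸ j) 0
        ≡⟨ cong (λ x → A j + multinomial n 1 j * Q (n ∸ x) (k ∸ j) 0) (sym (used-suc 0 j)) ⟩
      A j + cell n k 1 1 j ∎

  P-recurrence : ∀ n k r → P n k (suc r) ≡ viaFirstBlock S∖u (λ m → P m k r) n + (n C a) * P (n ∸ a) k r
  P-recurrence n k r =
    trans (stirlingTR-recurrence S n k r) (viaFirstBlock-remove S a (λ m → P m k r) n Su≡true)

  formula-suc : ∀ n k r → (∀ m → m ≤ n → P m k r ≡ rhs m k r) → P n k (suc r) ≡ rhs n k (suc r)
  formula-suc n k r ih = begin
    P n k (suc r)
      ≡⟨ P-recurrence n k r ⟩
    viaFirstBlock S∖u (λ m → P m k r) n + (n C a) * P (n ∸ a) k r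
      ≡⟨ cong₂ _+_ (viaFirstBlock-cong S∖u n ih) (cong ((n C a) *_) (ih (n ∸ a) (m∸n≤m n a))) ⟩
    viaFirstBlock S∖u (λ m → rhs m k r) n + (n C a) * rhs (n ∸ a) k r
      ≡⟨ sym (rhs-recurrence n k r) ⟩
    rhs n k (suc r) ∎

  formula-zero : ∀ n k → P n k 0 ≡ rhs n k 0
  formula-zero = <-rec (λ n → ∀ k → P n k 0 ≡ rhs n k 0) step
    where
    step : ∀ n → (∀ {m} → m < n → ∀ k → P m k 0 ≡ rhs m k 0) → ∀ k → P n k 0 ≡ rhs n k 0
    step zero    _  k       = trans (stirlingTR-empty S k) (sym (trans (rhs-empty k) (stirlingTR-empty S∖u k)))
    step (suc n) _  zero    = refl
    step (suc n) ih (suc k) = begin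
      P (suc n) (suc k) 0   ≡⟨ stirlingTR-shift S n k ⟩
      P n k 1               ≡⟨ formula-suc n k 0 (λ m m≤n → ih (s≤s m≤n) k) ⟩
      rhs n k 1             ≡⟨ sym (rhs-shift n k) ⟩
      rhs (suc n) (suc k) 0 ∎

  formula : ∀ r n k → P n k r ≡ rhs n k r
  formula zero    n k = formula-zero n k
  formula (suc r) n k = formula-suc n k r (λ m _ → formula r m k)

  summand : ℕ → ℕ → ℕ → ℕ → ℕ → ℕ
  summand n k r i j =
    if (suc a ∸ 1) * i + suc a * j ≤ᵇ n
    then (r C i) * coeff n (suc a) i j * Q (n ∸ ((suc a ∸ 1) * i + suc a * j)) (k ∸ j) (r ∸ i)
    else 0

  summand≡cell : ∀ n k r i j → summand n k r i j ≡ (r C i) * cell n k r i j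
  summand≡cell n k r i j with a * i + suc a * j ≤ᵇ n | ≤ᵇ-reflects-≤ (a * i + suc a * j) n
  ... | true  | ofʸ a*i+u*j≤n = begin
    (r C i) * coeff n (suc a) i j * Q (n ∸ (a * i + suc a * j)) (k ∸ j) (r ∸ i)
      ≡⟨ cong₂ (λ c x → (r C i) * c * Q (n ∸ x) (k ∸ j) (r ∸ i))
           (coeff≡multinomial n i j used≤n) (a*i+u*j≡used i j) ⟩
    (r C i) * multinomial n i j * Q (n ∸ used i j) (k ∸ j) (r ∸ i)
      ≡⟨ *-assoc (r C i) (multinomial n i j) (Q (n ∸ used i j) (k ∸ j) (r ∸ i)) ⟩
    (r C i) * cell n k r i j ∎
    where
    used≤n : used i j ≤ n
    used≤n = subst (_≤ n) (a*i+u*j≡used i j) a*i+u*j≤n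
  ... | false | ofⁿ a*i+u*j≰n = sym (begin
    (r C i) * (multinomial n i j * Q (n ∸ used i j) (k ∸ j) (r ∸ i))
      ≡⟨ cong (λ m → (r C i) * (m * Q (n ∸ used i j) (k ∸ j) (r ∸ i))) (multinomial-zero i j n<used) ⟩
    (r C i) * 0
      ≡⟨ *-zeroʳ (r C i) ⟩
    0 ∎)
    where
    n<used : n < used i j
    n<used = ≰⇒> (a*i+u*j≰n ∘ subst (_≤ n) (sym (a*i+u*j≡used i j)))

  rhs≡sumTo : ∀ n k r → rhs n k r ≡ sumTo r (λ i → sumTo k (summand n k r i))
  rhs≡sumTo n k r = sym (begin
    sumTo r (λ i → sumTo k (summand n k r i))
      ≡⟨ sumTo≡∑ℕ r (λ i → sumTo k (summand n k r i)) ⟩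
    ∑[ i < suc r ] sumTo k (summand n k r i)
      ≡⟨ ∑ℕ-cong (suc r) (λ i _ → begin
           sumTo k (summand n k r i)                ≡⟨ sumTo≡∑ℕ k (summand n k r i) ⟩
           ∑[ j < suc k ] summand n k r i j          ≡⟨ ∑ℕ-cong (suc k) (λ j _ → summand≡cell n k r i j) ⟩
           ∑[ j < suc k ] (r C i) * cell n k r i j   ≡⟨ sym (∑ℕ-*ˡ (suc k) (r C i) (cell n k r i)) ⟩
           (r C i) * row n k r i                     ∎) ⟩
    rhs n k r ∎)

mainTheorem3 : (S : Subset) → S 0 ≡ false → (u : ℕ) → S u ≡ true →
    (n k r : ℕ) →
    stirlingTR S n k r ≡
      sumTo r (λ i → sumTo k (λ j →
        if (u ∸ 1) * i + u * j ≤ᵇ n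
        then (r C i) * coeff n u i j
               * stirlingTR (S ∖｛ u ｝) (n ∸ ((u ∸ 1) * i + u * j)) (k ∸ j) (r ∸ i)
        else 0))
mainTheorem3 S S0≡false zero    S0≡true n k r = contradiction (trans (sym S0≡true) S0≡false) λ ()
mainTheorem3 S S0≡false (suc a) Su≡true n k r = trans (formula r n k) (rhs≡sumTo n k r)
  where open Formula S a Su≡true
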